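{- Let $f$ and $g$ be distinct elements of a matroid $M$ such that $f$ is freer than $g$ in $M$. Then $b(f;M)=b(g;M)$ if and only if $f$ and $g$ are clones in $M$.
   Context: For distinct elements $f,g$ of a matroid $M$, $f$ is freer than $g$ if $g$ is contained in the closure of every circuit of $M$ that contains $f$. $b(e;M)$ is the number of bases of $M$ containing $e$. Elements $x,y$ of $M$ are clones if the bijection $E(M)\to E(M)$ that interchanges $x$ and $y$ and fixes every other element is an automorphism of $M$. -}

module Defs where

open import Data.Bool using (Bool; true; false; _∧_; _∨_; not; if_then_else_)
open import Data.Nat using (ℕ; zero; suc; _<_; _⊔_)
open import Data.Fin using (Fin)
open import Data.Fin.Properties using (_≟_)
open import Data.Fin.Subset using (Subset; ⊥; ⁅_⁆; _∈_; _∉_; _⊆_; _⊂_; _∪_; ∣_∣)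
open import Data.Vec using (Vec; []; _∷_; lookup; tabulate)
open import Data.List using (List; []; _∷_; map; filter; length; foldr; _++_; allFin)
import Data.List.Base as List
open import Data.Product using (Σ; _×_; _,_)
open import Relation.Binary.PropositionalEquality using (_≡_)
open import Relation.Nullary using (¬_; does)
open import Relation.Nullary.Decidable using (⌊_⌋)
open import Data.Bool.Properties using (T?)

record Matroid (n : ℕ) : Set where
  field
    indep        : Subset n → Bool
    indep-empty  : indep ⊥ ≡ true
    indep-hered  : ∀ {X Y} → Y ⊆ X → indep X ≡ true → indep Y ≡ true
    indep-augment : ∀ {X Y} → indep X ≡ true → indep Y ≡ true → ∣ X ∣ < ∣ Y ∣ →
                    Σ (Fin n) λ e → e ∈ Y × e ∉ X × indep (X ∪ ⁅ e ⁆) ≡ true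

open Matroid public

memb : ∀ {n} → Fin n → Subset n → Bool
memb e X = lookup X e

allSubsets : (n : ℕ) → List (Subset n)
allSubsets zero = [] ∷ []
allSubsets (suc n) = map (false ∷_) (allSubsets n) ++ map (true ∷_) (allSubsets n)

subsetB : ∀ {n} → Subset n → Subset n → Bool
subsetB X Y = List.all (λ i → not (memb i X) ∨ memb i Y) (allFin _)

module _ {n : ℕ} (M : Matroid n) where

  isBasis : Subset n → Bool
  isBasis B = indep M B ∧ List.all (λ e → memb e B ∨ not (indep M (B ∪ ⁅ e ⁆))) (allFin n)

  b : Fin n → ℕ
  b e = length (filter (λ B → T? (isBasis B ∧ memb e B)) (allSubsets n))

  rank : Subset n → ℕ
  rank X = foldr _⊔_ 0 (map ∣_∣ (filter (λ I → T? (indep M I ∧ subsetB I X)) (allSubsets n)))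

  _∈cl_ : Fin n → Subset n → Set
  e ∈cl X = rank (X ∪ ⁅ e ⁆) ≡ rank X

  IsCircuit : Subset n → Set
  IsCircuit C = indep M C ≡ false × (∀ D → D ⊂ C → indep M D ≡ true)

  Freer : Fin n → Fin n → Set
  Freer f g = ∀ C → IsCircuit C → f ∈ C → g ∈cl C

  swap : Fin n → Fin n → Fin n → Fin n
  swap x y i = if does (i ≟ x) then y else (if does (i ≟ y) then x else i)

  -- image of X under the transposition (an involution, so image = preimage)
  swapSet : Fin n → Fin n → Subset n → Subset n
  swapSet x y X = tabulate (λ i → lookup X (swap x y i))

  Clones : Fin n → Fin n → Set
  Clones x y = ∀ X → indep M (swapSet x y X) ≡ indep M X

module Submission where

-- Write φ for the transposition of f and g acting on subsets. If f is freer than g, then φ sends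
-- every basis B with g ∈ B, f ∉ B to a basis: otherwise φ B contains a circuit C, which avoids g;
-- if f ∉ C then φ C = C, and if f ∈ C then φ C is an independent subset of C ∪ g of size ∣ C ∣,
-- contradicting r(C ∪ g) = r(C) < ∣ C ∣. So B ↦ φ B injects the bases containing g into those
-- containing f, and b(f;M) = b(g;M) exactly when it is onto, i.e. when φ maps bases to bases.
-- As every independent set lies in a basis and all bases are equicardinal, this holds exactly
-- when φ is an automorphism.

open import Defs
open import Data.Nat using (ℕ)
open import Data.Fin using (Fin)
open import Relation.Binary.PropositionalEquality using (_≡_)
open import Relation.Nullary using (¬_)
open import Data.Product using (_×_)

open import Data.Nat using (zero; suc; _≤_; _<_; z≤n; s≤s)
open import Data.Nat.Properties
  using (≤-reflexive; <-irrefl; m≤n⇒m≤1+n; m<n⇒m<1+n; m≤n⇒m≤n⊔o; m≤n⇒m≤o⊔n; ⊔-lub;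
         module ≤-Reasoning)
open import Data.Nat.Induction using (<-wellFounded)
open import Induction.WellFounded using (Acc; acc)
open import Data.Bool using (Bool; true; false; T; not; _∧_; _∨_; if_then_else_)
open import Data.Bool.Properties using (T?; T-≡; T-∧; ¬-not) renaming (_≟_ to _≟ᵇ_)
open import Data.Empty using (⊥-elim)
open import Data.Fin using (zero; suc)
open import Data.Fin.Properties using (_≟_; any?)
open import Data.Fin.Subset using (Subset; ⁅_⁆; _∈_; _∉_; _⊆_; _⊂_; _∪_; _-_; ∣_∣)
open import Data.Fin.Subset.Properties
  using (_∈?_; _⊂?_; ⊆-antisym; ∪-identityʳ; ∣⁅x⁆∣≡1; x∈⁅x⁆; x∈⁅y⁆⇒x≡y; p⊆q⇒∣p∣≤∣q∣;
         p⊂q⇒∣p∣<∣q∣; x∈p⇒∣p-x∣<∣p∣; x∈p∧x≢y⇒x∈p-y; p─q⊆p; p⊆p∪q; q⊆p∪q; x∈p∪q⁻; x∈p∪q⁺;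
         nonempty?; Empty-unique)
open import Data.Vec using ([]; _∷_; lookup)
open import Data.Vec.Properties
  using (lookup∘tabulate; tabulate∘lookup; tabulate-cong; ∷-injectiveʳ; []=⇒lookup; lookup⇒[]=)
open import Data.List using (List; []; _∷_; length; filter; map; allFin)
import Data.List as List
open import Data.List.Properties using (filter-≐; map-tabulate; foldr-preservesᵇ; foldr-preservesᵒ)
open import Data.List.Membership.Propositional using () renaming (_∈_ to _∈ₗ_)
open import Data.List.Membership.Propositional.Properties
  using (∈-map⁺; ∈-map⁻; ∈-++⁺ˡ; ∈-++⁺ʳ; ∈-filter⁺; ∈-filter⁻; ∈-allFin)
open import Data.List.Membership.Propositional.Properties.WithK using (unique∧set⇒bag)
open import Data.List.Relation.Binary.BagAndSetEquality using (∼bag⇒↭)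
open import Data.List.Relation.Binary.Permutation.Propositional using (_↭_)
open import Data.List.Relation.Binary.Permutation.Propositional.Properties using (↭-length; filter-↭)
open import Data.List.Relation.Unary.All as All using (All)
open import Data.List.Relation.Unary.All.Properties using (all⁺; all⁻)
open import Data.List.Relation.Unary.Any as Any using (here; there)
open import Data.List.Relation.Unary.AllPairs using ([]; _∷_)
open import Data.List.Relation.Unary.Unique.Propositional using (Unique)
import Data.List.Relation.Unary.Unique.Propositional.Properties as Unique
open import Data.Product using (∃-syntax; _,_; proj₁; proj₂)
open import Data.Sum using (inj₁; inj₂; [_,_])
open import Function using (_∘_; id)
open import Function.Bundles using (Equivalence; mk⇔)
open import Relation.Binary.PropositionalEquality
  using (refl; sym; trans; cong; cong₂; subst; _≢_; module ≡-Reasoning)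
open import Relation.Nullary using (yes; no; contradiction)
open import Relation.Nullary.Decidable using (dec-true; dec-false; _×-dec_)

≡true-ext : ∀ {a b : Bool} → (a ≡ true → b ≡ true) → (b ≡ true → a ≡ true) → a ≡ b
≡true-ext {false} {false} _   _   = refl
≡true-ext {false} {true}  _   b⇒a = b⇒a refl
≡true-ext {true}  {false} a⇒b _   = sym (a⇒b refl)
≡true-ext {true}  {true}  _   _   = refl

∧≡true⁻ : ∀ {a b : Bool} → a ∧ b ≡ true → a ≡ true × b ≡ true
∧≡true⁻ {true} {true} _ = refl , refl

countᵇ : ∀ {A : Set} → (A → Bool) → List A → ℕ
countᵇ p xs = length (filter (T? ∘ p) xs)

countᵇ-map : ∀ {A B : Set} (p : A → Bool) (f : B → A) xs →
             countᵇ p (map f xs) ≡ countᵇ (p ∘ f) xs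
countᵇ-map p f []       = refl
countᵇ-map p f (x ∷ xs) with p (f x)
... | true  = cong suc (countᵇ-map p f xs)
... | false = countᵇ-map p f xs

countᵇ-tabulate : ∀ {A : Set} {n} (p : A → Bool) (f : Fin n → A) →
                  countᵇ p (List.tabulate f) ≡ countᵇ (p ∘ f) (allFin n)
countᵇ-tabulate p f = trans (cong (countᵇ p) (sym (map-tabulate id f))) (countᵇ-map p f (allFin _))

module _ {A : Set} where

  countᵇ-cong : ∀ {p q : A → Bool} → (∀ x → p x ≡ q x) → ∀ xs → countᵇ p xs ≡ countᵇ q xs
  countᵇ-cong {p} {q} p≗q xs = cong length (filter-≐ (T? ∘ p) (T? ∘ q) (p⇒q , q⇒p) xs)
    where
    p⇒q : ∀ {x} → T (p x) → T (q x)
    p⇒q {x} = subst T (p≗q x)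
    q⇒p : ∀ {x} → T (q x) → T (p x)
    q⇒p {x} = subst T (sym (p≗q x))

  countᵇ-↭ : ∀ (p : A → Bool) {xs ys} → xs ↭ ys → countᵇ p xs ≡ countᵇ p ys
  countᵇ-↭ p xs↭ys = ↭-length (filter-↭ (T? ∘ p) xs↭ys)

  countᵇ-mono : ∀ {p q : A → Bool} → (∀ x → p x ≡ true → q x ≡ true) →
                ∀ xs → countᵇ p xs ≤ countᵇ q xs
  countᵇ-mono         p⇒q []       = z≤n
  countᵇ-mono {p} {q} p⇒q (x ∷ xs) with p x in px
  ... | true rewrite p⇒q x px = s≤s (countᵇ-mono p⇒q xs)
  ... | false with q x
  ...   | true  = m≤n⇒m≤1+n (countᵇ-mono p⇒q xs)
  ...   | false = countᵇ-mono p⇒q xs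

  countᵇ-mono-< : ∀ {p q : A → Bool} → (∀ x → p x ≡ true → q x ≡ true) →
                  ∀ {y xs} → y ∈ₗ xs → p y ≡ false → q y ≡ true → countᵇ p xs < countᵇ q xs
  countᵇ-mono-< p⇒q {xs = _ ∷ xs} (here refl) py qy rewrite py | qy = s≤s (countᵇ-mono p⇒q xs)
  countᵇ-mono-< {p} {q} p⇒q {xs = x ∷ _} (there y∈) py qy with p x in px
  ... | true rewrite p⇒q x px = s≤s (countᵇ-mono-< p⇒q y∈ py qy)
  ... | false with q x
  ...   | true  = m<n⇒m<1+n (countᵇ-mono-< p⇒q y∈ py qy)
  ...   | false = countᵇ-mono-< p⇒q y∈ py qy

  involution-map-↭ : ∀ {σ : A → A} {xs} → Unique xs → (∀ x → x ∈ₗ xs) → (∀ x → σ (σ x) ≡ x) →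
                     map σ xs ↭ xs
  involution-map-↭ {σ} {xs} unique complete σσ =
    ∼bag⇒↭ (unique∧set⇒bag (Unique.map⁺ σ-injective unique) unique (mk⇔ (λ _ → complete _) σ-onto))
    where
    σ-injective : ∀ {x y} → σ x ≡ σ y → x ≡ y
    σ-injective {x} {y} σx≡σy = trans (sym (σσ x)) (trans (cong σ σx≡σy) (σσ y))
    σ-onto : ∀ {x} → x ∈ₗ xs → x ∈ₗ map σ xs
    σ-onto {x} _ = subst (_∈ₗ map σ xs) (σσ x) (∈-map⁺ σ (complete (σ x)))

  countᵇ-involution : ∀ {σ : A → A} {xs} → Unique xs → (∀ x → x ∈ₗ xs) → (∀ x → σ (σ x) ≡ x) →
                      ∀ {p q : A → Bool} → (∀ x → q x ≡ p (σ x)) → countᵇ q xs ≡ countᵇ p xs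
  countᵇ-involution {σ} {xs} unique complete σσ {p} {q} q≗p∘σ = begin
    countᵇ q xs          ≡⟨ countᵇ-cong q≗p∘σ xs ⟩
    countᵇ (p ∘ σ) xs    ≡⟨ countᵇ-map p σ xs ⟨
    countᵇ p (map σ xs)  ≡⟨ countᵇ-↭ p (involution-map-↭ unique complete σσ) ⟩
    countᵇ p xs          ∎
    where open ≡-Reasoning

allSubsets-complete : ∀ {n} (X : Subset n) → X ∈ₗ allSubsets n
allSubsets-complete []                 = here refl
allSubsets-complete (false ∷ X)        = ∈-++⁺ˡ (∈-map⁺ (false ∷_) (allSubsets-complete X))
allSubsets-complete {suc n} (true ∷ X) =
  ∈-++⁺ʳ (map (false ∷_) (allSubsets n)) (∈-map⁺ (true ∷_) (allSubsets-complete X))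

allSubsets-unique : ∀ n → Unique (allSubsets n)
allSubsets-unique zero    = All.[] ∷ []
allSubsets-unique (suc n) =
  Unique.++⁺ (Unique.map⁺ ∷-injectiveʳ (allSubsets-unique n))
             (Unique.map⁺ ∷-injectiveʳ (allSubsets-unique n))
             disjoint
  where
  disjoint : ∀ {X} → ¬ (X ∈ₗ map (false ∷_) (allSubsets n) × X ∈ₗ map (true ∷_) (allSubsets n))
  disjoint (X∈ , X∈′) with ∈-map⁻ (false ∷_) X∈ | ∈-map⁻ (true ∷_) X∈′
  ... | _ , _ , refl | _ , _ , ()

∣∣≡countᵇ-lookup : ∀ {n} (X : Subset n) → ∣ X ∣ ≡ countᵇ (lookup X) (allFin n)
∣∣≡countᵇ-lookup []          = refl
∣∣≡countᵇ-lookup (true ∷ X)  =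
  cong suc (trans (∣∣≡countᵇ-lookup X) (sym (countᵇ-tabulate (lookup (true ∷ X)) suc)))
∣∣≡countᵇ-lookup (false ∷ X) =
  trans (∣∣≡countᵇ-lookup X) (sym (countᵇ-tabulate (lookup (false ∷ X)) suc))

∉⇒lookup≡false : ∀ {n} {X : Subset n} {x} → x ∉ X → lookup X x ≡ false
∉⇒lookup≡false {X = X} {x} x∉X = ¬-not λ Xx≡true → x∉X (lookup⇒[]= x X Xx≡true)

lookup≡false⇒∉ : ∀ {n} {X : Subset n} {x} → lookup X x ≡ false → x ∉ X
lookup≡false⇒∉ Xx≡false x∈X = contradiction (trans (sym ([]=⇒lookup x∈X)) Xx≡false) λ ()

∣∪⁅⁆∣ : ∀ {n} {X : Subset n} {e} → e ∉ X → ∣ X ∪ ⁅ e ⁆ ∣ ≡ suc ∣ X ∣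
∣∪⁅⁆∣ {X = false ∷ X} {zero}  _   = cong (suc ∘ ∣_∣) (∪-identityʳ X)
∣∪⁅⁆∣ {X = true ∷ _}  {zero}  e∉X = contradiction Data.Vec.here e∉X
∣∪⁅⁆∣ {X = false ∷ _} {suc _} e∉X = ∣∪⁅⁆∣ (e∉X ∘ Data.Vec.there)
∣∪⁅⁆∣ {X = true ∷ _}  {suc _} e∉X = cong suc (∣∪⁅⁆∣ (e∉X ∘ Data.Vec.there))

module _ {n} (M : Matroid n) (x y : Fin n) where

  swap-x : swap M x y x ≡ y
  swap-x rewrite dec-true (x ≟ x) refl = refl

  swap-y : swap M x y y ≡ x
  swap-y with y ≟ x
  ... | yes y≡x = y≡x
  ... | no _ rewrite dec-true (y ≟ y) refl = refl

  swap-other : ∀ {i} → i ≢ x → i ≢ y → swap M x y i ≡ i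
  swap-other {i} i≢x i≢y rewrite dec-false (i ≟ x) i≢x | dec-false (i ≟ y) i≢y = refl

  swap-involutive : ∀ i → swap M x y (swap M x y i) ≡ i
  swap-involutive i with i ≟ x
  ... | yes refl = swap-y
  ... | no i≢x with i ≟ y
  ...   | yes refl = swap-x
  ...   | no i≢y   = swap-other i≢x i≢y

  lookup-swapSet : ∀ X i → lookup (swapSet M x y X) i ≡ lookup X (swap M x y i)
  lookup-swapSet X = lookup∘tabulate (lookup X ∘ swap M x y)

  lookup-swapSet-x : ∀ X → lookup (swapSet M x y X) x ≡ lookup X y
  lookup-swapSet-x X = trans (lookup-swapSet X x) (cong (lookup X) swap-x)

  lookup-swapSet-y : ∀ X → lookup (swapSet M x y X) y ≡ lookup X x
  lookup-swapSet-y X = trans (lookup-swapSet X y) (cong (lookup X) swap-y)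

  swapSet-involutive : ∀ X → swapSet M x y (swapSet M x y X) ≡ X
  swapSet-involutive X = trans (tabulate-cong twice) (tabulate∘lookup X)
    where
    twice : ∀ i → lookup (swapSet M x y X) (swap M x y i) ≡ lookup X i
    twice i = trans (lookup-swapSet X (swap M x y i)) (cong (lookup X) (swap-involutive i))

  swapSet-fixes : ∀ {X} → lookup X x ≡ lookup X y → swapSet M x y X ≡ X
  swapSet-fixes {X} Xx≡Xy = trans (tabulate-cong fixed) (tabulate∘lookup X)
    where
    fixed : ∀ i → lookup X (swap M x y i) ≡ lookup X i
    fixed i with i ≟ x
    ... | yes refl = sym Xx≡Xy
    ... | no i≢x with i ≟ y
    ...   | yes refl = Xx≡Xy
    ...   | no _     = refl

  swapSet-fixes-∈ : ∀ {X} → x ∈ X → y ∈ X → swapSet M x y X ≡ X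
  swapSet-fixes-∈ x∈X y∈X = swapSet-fixes (trans ([]=⇒lookup x∈X) (sym ([]=⇒lookup y∈X)))

  swapSet-fixes-∉ : ∀ {X} → x ∉ X → y ∉ X → swapSet M x y X ≡ X
  swapSet-fixes-∉ x∉X y∉X = swapSet-fixes (trans (∉⇒lookup≡false x∉X) (sym (∉⇒lookup≡false y∉X)))

  ∈-swapSet⁻ : ∀ {X i} → i ∈ swapSet M x y X → swap M x y i ∈ X
  ∈-swapSet⁻ {X} {i} i∈ = lookup⇒[]= _ X (trans (sym (lookup-swapSet X i)) ([]=⇒lookup i∈))

  ∈-swapSet⁺ : ∀ {X i} → swap M x y i ∈ X → i ∈ swapSet M x y X
  ∈-swapSet⁺ {X} {i} σi∈ = lookup⇒[]= i _ (trans (lookup-swapSet X i) ([]=⇒lookup σi∈))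

  swapSet-mono : ∀ {X Y} → X ⊆ Y → swapSet M x y X ⊆ swapSet M x y Y
  swapSet-mono X⊆Y = ∈-swapSet⁺ ∘ X⊆Y ∘ ∈-swapSet⁻

  ∣swapSet∣ : ∀ X → ∣ swapSet M x y X ∣ ≡ ∣ X ∣
  ∣swapSet∣ X = begin
    ∣ swapSet M x y X ∣                          ≡⟨ ∣∣≡countᵇ-lookup (swapSet M x y X) ⟩
    countᵇ (lookup (swapSet M x y X)) (allFin n)  ≡⟨ countᵇ-involution (Unique.allFin⁺ n) ∈-allFin swap-involutive
                                                                        (lookup-swapSet X) ⟩
    countᵇ (lookup X) (allFin n)                  ≡⟨ ∣∣≡countᵇ-lookup X ⟨
    ∣ X ∣                                         ∎
    where open ≡-Reasoning

  swapSet-⊆-∪⁅⁆ : ∀ {C} → y ∉ C → swapSet M x y C ⊆ C ∪ ⁅ y ⁆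
  swapSet-⊆-∪⁅⁆ {C} y∉C {i} i∈ with i ≟ y
  ... | yes refl = x∈p∪q⁺ (inj₂ (x∈⁅x⁆ i))
  ... | no i≢y with i ≟ x
  ...   | yes refl = contradiction (subst (_∈ C) swap-x (∈-swapSet⁻ i∈)) y∉C
  ...   | no i≢x   = x∈p∪q⁺ (inj₁ (subst (_∈ C) (swap-other i≢x i≢y) (∈-swapSet⁻ i∈)))

module _ {n} (M : Matroid n) where

  dependent-mono : ∀ {X Y} → X ⊆ Y → indep M X ≡ false → indep M Y ≡ false
  dependent-mono {Y = Y} X⊆Y X-dep with indep M Y in Y-indep
  ... | true  = trans (sym (indep-hered M X⊆Y Y-indep)) X-dep
  ... | false = refl

  Maximal : Subset n → Set
  Maximal B = ∀ {e} → e ∉ B → indep M (B ∪ ⁅ e ⁆) ≡ false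

  private
    maximalAt : Subset n → Fin n → Bool
    maximalAt B e = lookup B e ∨ not (indep M (B ∪ ⁅ e ⁆))

    maximalAt⁻ : ∀ {B e} → T (maximalAt B e) → e ∉ B → indep M (B ∪ ⁅ e ⁆) ≡ false
    maximalAt⁻ {B} {e} max e∉B with lookup B e in Be | indep M (B ∪ ⁅ e ⁆)
    ... | true  | _     = contradiction (lookup⇒[]= e B Be) e∉B
    ... | false | false = refl
    ... | false | true  = ⊥-elim max

    maximalAt⁺ : ∀ {B e} → (e ∉ B → indep M (B ∪ ⁅ e ⁆) ≡ false) → T (maximalAt B e)
    maximalAt⁺ {B} {e} max with lookup B e in Be
    ... | true  = _
    ... | false rewrite max (lookup≡false⇒∉ Be) = _

  isBasis⁻ : ∀ {B} → isBasis M B ≡ true → indep M B ≡ true × Maximal B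
  isBasis⁻ {B} basis with Equivalence.to T-∧ (Equivalence.from T-≡ basis)
  ... | indB , maxB =
    Equivalence.to T-≡ indB , λ {e} → maximalAt⁻ (All.lookup (all⁺ _ (allFin n) maxB) (∈-allFin e))

  isBasis⁺ : ∀ {B} → indep M B ≡ true → Maximal B → isBasis M B ≡ true
  isBasis⁺ {B} indB maxB = Equivalence.to T-≡ (Equivalence.from T-∧
    (Equivalence.from T-≡ indB ,
     all⁻ (maximalAt B) {xs = allFin n} (All.tabulate λ {e} _ → maximalAt⁺ {B} {e} maxB)))

  indep-∣∣≥⇒isBasis : ∀ {B I} → isBasis M B ≡ true → indep M I ≡ true → ∣ B ∣ ≤ ∣ I ∣ →
                      isBasis M I ≡ true
  indep-∣∣≥⇒isBasis {B} {I} basis indI ∣B∣≤∣I∣ = isBasis⁺ indI maxI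
    where
    ∣B∣<∣I∪⁅⁆∣ : ∀ {e} → e ∉ I → ∣ B ∣ < ∣ I ∪ ⁅ e ⁆ ∣
    ∣B∣<∣I∪⁅⁆∣ e∉I = subst (∣ B ∣ <_) (sym (∣∪⁅⁆∣ e∉I)) (s≤s ∣B∣≤∣I∣)
    maxI : Maximal I
    maxI {e} e∉I with indep M (I ∪ ⁅ e ⁆) in indIe
    ... | false = refl
    ... | true with indep-augment M (proj₁ (isBasis⁻ basis)) indIe (∣B∣<∣I∪⁅⁆∣ e∉I)
    ...   | z , _ , z∉B , indBz = trans (sym indBz) (proj₂ (isBasis⁻ basis) z∉B)

  greedy : Subset n → List (Fin n) → Subset n
  greedy X []       = X
  greedy X (e ∷ es) = if indep M (X ∪ ⁅ e ⁆) then greedy (X ∪ ⁅ e ⁆) es else greedy X es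

  greedy-indep : ∀ {X} → indep M X ≡ true → ∀ es → indep M (greedy X es) ≡ true
  greedy-indep         indX []       = indX
  greedy-indep {X} indX (e ∷ es) with indep M (X ∪ ⁅ e ⁆) in indXe
  ... | true  = greedy-indep indXe es
  ... | false = greedy-indep indX es

  greedy-⊇ : ∀ X es → X ⊆ greedy X es
  greedy-⊇ X []       = id
  greedy-⊇ X (e ∷ es) with indep M (X ∪ ⁅ e ⁆)
  ... | true  = greedy-⊇ (X ∪ ⁅ e ⁆) es ∘ p⊆p∪q ⁅ e ⁆
  ... | false = greedy-⊇ X es

  greedy-maximal : ∀ X es {e} → e ∈ₗ es → e ∉ greedy X es →
                   indep M (greedy X es ∪ ⁅ e ⁆) ≡ false
  greedy-maximal X (e ∷ es) (here refl) e∉ with indep M (X ∪ ⁅ e ⁆) in indXe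
  ... | true  = contradiction (greedy-⊇ (X ∪ ⁅ e ⁆) es (q⊆p∪q X ⁅ e ⁆ (x∈⁅x⁆ e))) e∉
  ... | false = dependent-mono ∪⁅e⁆-mono indXe
    where
    ∪⁅e⁆-mono : X ∪ ⁅ e ⁆ ⊆ greedy X es ∪ ⁅ e ⁆
    ∪⁅e⁆-mono i∈ = x∈p∪q⁺ ([ inj₁ ∘ greedy-⊇ X es , inj₂ ] (x∈p∪q⁻ X ⁅ e ⁆ i∈))
  greedy-maximal X (e ∷ es) (there e′∈) e′∉ with indep M (X ∪ ⁅ e ⁆)
  ... | true  = greedy-maximal (X ∪ ⁅ e ⁆) es e′∈ e′∉
  ... | false = greedy-maximal X es e′∈ e′∉

  indep⇒⊆basis : ∀ {X} → indep M X ≡ true → ∃[ B ] isBasis M B ≡ true × X ⊆ B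
  indep⇒⊆basis {X} indX =
    greedy X (allFin n) ,
    isBasis⁺ (greedy-indep indX (allFin n)) (greedy-maximal X (allFin n) (∈-allFin _)) ,
    greedy-⊇ X (allFin n)

  circuit⊆ : ∀ {D} → Acc _<_ ∣ D ∣ → indep M D ≡ false → ∃[ C ] C ⊆ D × IsCircuit M C
  circuit⊆ {D} (acc smaller) D-dep with any? (λ x → x ∈? D ×-dec indep M (D - x) ≟ᵇ false)
  ... | yes (x , x∈D , D-x-dep) with circuit⊆ (smaller (x∈p⇒∣p-x∣<∣p∣ x∈D)) D-x-dep
  ...   | C , C⊆D-x , circuit = C , p─q⊆p D ⁅ x ⁆ ∘ C⊆D-x , circuit
  circuit⊆ {D} (acc _) D-dep | no ¬∃ = D , id , D-dep , minimal
    where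
    minimal : ∀ D′ → D′ ⊂ D → indep M D′ ≡ true
    minimal D′ (D′⊆D , x , x∈D , x∉D′) =
      indep-hered M (λ z∈D′ → x∈p∧x≢y⇒x∈p-y (D′⊆D z∈D′) λ { refl → x∉D′ z∈D′ })
                    (¬-not λ D-x-dep → ¬∃ (x , x∈D , D-x-dep))

  dependent⇒⊇circuit : ∀ {D} → indep M D ≡ false → ∃[ C ] C ⊆ D × IsCircuit M C
  dependent⇒⊇circuit = circuit⊆ (<-wellFounded _)

  dependent⇒∣∣>0 : ∀ {X} → indep M X ≡ false → 0 < ∣ X ∣
  dependent⇒∣∣>0 {X} X-dep with nonempty? X
  ... | yes (x , x∈X) =
    subst (_≤ ∣ X ∣) (∣⁅x⁆∣≡1 x) (p⊆q⇒∣p∣≤∣q∣ λ z∈ → subst (_∈ X) (sym (x∈⁅y⁆⇒x≡y x z∈)) x∈X)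
  ... | no empty =
    contradiction (trans (sym X-dep) (trans (cong (indep M) (Empty-unique empty)) (indep-empty M))) λ ()

  indep⊆dependent⇒∣∣< : ∀ {I D} → indep M I ≡ true → I ⊆ D → indep M D ≡ false →
                        ∣ I ∣ < ∣ D ∣
  indep⊆dependent⇒∣∣< {I} {D} indI I⊆D D-dep with I ⊂? D
  ... | yes I⊂D = p⊂q⇒∣p∣<∣q∣ I⊂D
  ... | no I⊄D =
    contradiction (trans (sym indI) (trans (cong (indep M) (⊆-antisym I⊆D D⊆I)) D-dep)) λ ()
    where
    D⊆I : D ⊆ I
    D⊆I {z} z∈D with z ∈? I
    ... | yes z∈I = z∈I
    ... | no z∉I  = contradiction ((λ {x} → I⊆D {x}) , z , z∈D , z∉I) I⊄D

  private
    subsetB⁺ : ∀ {I X : Subset n} → I ⊆ X → T (subsetB I X)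
    subsetB⁺ {I} {X} I⊆X = all⁻ _ {xs = allFin n} (All.tabulate λ {i} _ → pointwise i)
      where
      pointwise : ∀ i → T (not (lookup I i) ∨ lookup X i)
      pointwise i with lookup I i in Ii
      ... | true  = Equivalence.from T-≡ ([]=⇒lookup (I⊆X (lookup⇒[]= i I Ii)))
      ... | false = _

    subsetB⁻ : ∀ {I X : Subset n} → T (subsetB I X) → I ⊆ X
    subsetB⁻ {I} {X} t {i} i∈I with All.lookup (all⁺ _ (allFin n) t) (∈-allFin i)
    ... | pointwise rewrite []=⇒lookup i∈I = lookup⇒[]= i X (Equivalence.to T-≡ pointwise)

    indepWithin : Subset n → Subset n → Bool
    indepWithin X I = indep M I ∧ subsetB I X

    rankCandidates : Subset n → List ℕ
    rankCandidates X = map ∣_∣ (filter (T? ∘ indepWithin X) (allSubsets n))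

  ∣∣≤rank : ∀ {I X} → indep M I ≡ true → I ⊆ X → ∣ I ∣ ≤ rank M X
  ∣∣≤rank {I} {X} indI I⊆X =
    foldr-preservesᵒ (λ a b → [ m≤n⇒m≤n⊔o b , m≤n⇒m≤o⊔n a ]) 0 (rankCandidates X)
                     (inj₂ (Any.map ≤-reflexive I∈))
    where
    I∈ : ∣ I ∣ ∈ₗ rankCandidates X
    I∈ = ∈-map⁺ ∣_∣ (∈-filter⁺ (T? ∘ indepWithin X) (allSubsets-complete I)
                                (Equivalence.from T-∧ (Equivalence.from T-≡ indI , subsetB⁺ I⊆X)))

  rank<∣∣ : ∀ {X} → indep M X ≡ false → rank M X < ∣ X ∣
  rank<∣∣ {X} X-dep = foldr-preservesᵇ ⊔-lub (dependent⇒∣∣>0 X-dep) (All.tabulate bounded)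
    where
    bounded : ∀ {k} → k ∈ₗ rankCandidates X → k < ∣ X ∣
    bounded k∈ with ∈-map⁻ ∣_∣ k∈
    ... | I , I∈ , refl
        with Equivalence.to T-∧ (proj₂ (∈-filter⁻ (T? ∘ indepWithin X) {xs = allSubsets n} I∈))
    ...   | indI , I⊆X = indep⊆dependent⇒∣∣< (Equivalence.to T-≡ indI) (subsetB⁻ I⊆X) X-dep

module _ {n} (M : Matroid n) (f g : Fin n) where

  freer⇒swapSet-circuit-dependent : Freer M f g → ∀ {C} → IsCircuit M C → g ∉ C →
                                    indep M (swapSet M f g C) ≡ false
  freer⇒swapSet-circuit-dependent freer {C} circuit g∉C with f ∈? C
  ... | no f∉C = trans (cong (indep M) (swapSet-fixes-∉ M f g f∉C g∉C)) (proj₁ circuit)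
  ... | yes f∈C with indep M (swapSet M f g C) in indφC
  ...   | false = refl
  ...   | true  = ⊥-elim (<-irrefl refl (begin-strict
    ∣ C ∣                   ≡⟨ ∣swapSet∣ M f g C ⟨
    ∣ swapSet M f g C ∣     ≤⟨ ∣∣≤rank M indφC (swapSet-⊆-∪⁅⁆ M f g g∉C) ⟩
    rank M (C ∪ ⁅ g ⁆)      ≡⟨ freer C circuit f∈C ⟩
    rank M C                <⟨ rank<∣∣ M (proj₁ circuit) ⟩
    ∣ C ∣                   ∎))
    where open ≤-Reasoning

  freer⇒swapSet-basis : Freer M f g → ∀ {B} → isBasis M B ≡ true → g ∈ B →
                        isBasis M (swapSet M f g B) ≡ true
  freer⇒swapSet-basis freer {B} basis g∈B with f ∈? B
  ... | yes f∈B = subst (λ X → isBasis M X ≡ true) (sym (swapSet-fixes-∈ M f g f∈B g∈B)) basis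
  ... | no f∉B = indep-∣∣≥⇒isBasis M basis indφB (≤-reflexive (sym (∣swapSet∣ M f g B)))
    where
    indφB : indep M (swapSet M f g B) ≡ true
    indφB with indep M (swapSet M f g B) in φB-indep
    ... | true  = refl
    ... | false with dependent⇒⊇circuit M φB-indep
    ...   | C , C⊆φB , circuit = trans (sym (freer⇒swapSet-circuit-dependent freer circuit g∉C))
                                       (indep-hered M φC⊆B (proj₁ (isBasis⁻ M basis)))
      where
      g∉C : g ∉ C
      g∉C g∈C = f∉B (subst (_∈ B) (swap-y M f g) (∈-swapSet⁻ M f g (C⊆φB g∈C)))
      φC⊆B : swapSet M f g C ⊆ B
      φC⊆B = subst (swapSet M f g C ⊆_) (swapSet-involutive M f g B) (swapSet-mono M f g C⊆φB)

  SwapPreservesBases : Set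
  SwapPreservesBases = ∀ {B} → isBasis M B ≡ true → isBasis M (swapSet M f g B) ≡ true

  swapPreservesBases⇒isBasis-≡ : SwapPreservesBases → ∀ B → isBasis M (swapSet M f g B) ≡ isBasis M B
  swapPreservesBases⇒isBasis-≡ preserves B =
    ≡true-ext (subst (λ X → isBasis M X ≡ true) (swapSet-involutive M f g B) ∘ preserves) preserves

  swapPreservesBases⇒clones : SwapPreservesBases → Clones M f g
  swapPreservesBases⇒clones preserves X =
    ≡true-ext (subst (λ Y → indep M Y ≡ true) (swapSet-involutive M f g X) ∘ preservesIndep) preservesIndep
    where
    preservesIndep : ∀ {Y} → indep M Y ≡ true → indep M (swapSet M f g Y) ≡ true
    preservesIndep indY with indep⇒⊆basis M indY
    ... | B , basis , Y⊆B =
      indep-hered M (swapSet-mono M f g Y⊆B) (proj₁ (isBasis⁻ M (preserves basis)))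

  clones⇒swapPreservesBases : Clones M f g → SwapPreservesBases
  clones⇒swapPreservesBases clones {B} basis =
    indep-∣∣≥⇒isBasis M basis (trans (clones B) (proj₁ (isBasis⁻ M basis)))
                               (≤-reflexive (sym (∣swapSet∣ M f g B)))

  basisWith : Fin n → Subset n → Bool
  basisWith e B = isBasis M B ∧ memb e B

  swapPreservesBases⇒b≡ : SwapPreservesBases → b M f ≡ b M g
  swapPreservesBases⇒b≡ preserves =
    countᵇ-involution (allSubsets-unique n) allSubsets-complete (swapSet-involutive M f g) swapped
    where
    swapped : ∀ B → basisWith f B ≡ basisWith g (swapSet M f g B)
    swapped B = sym (cong₂ _∧_ (swapPreservesBases⇒isBasis-≡ preserves B) (lookup-swapSet-y M f g B))

  freer⇒basisWith-swap : Freer M f g → ∀ B → basisWith g B ≡ true →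
                         basisWith f (swapSet M f g B) ≡ true
  freer⇒basisWith-swap freer B gB with ∧≡true⁻ gB
  ... | basis , Bg =
    cong₂ _∧_ (freer⇒swapSet-basis freer basis (lookup⇒[]= g B Bg)) (trans (lookup-swapSet-x M f g B) Bg)

  freer⇒b< : Freer M f g → ∀ {Y} → basisWith g Y ≡ false → basisWith f (swapSet M f g Y) ≡ true →
             b M g < b M f
  freer⇒b< freer {Y} gY fφY = begin-strict
    countᵇ (basisWith g) (allSubsets n)                  <⟨ countᵇ-mono-< (freer⇒basisWith-swap freer)
                                                                          (allSubsets-complete Y) gY fφY ⟩
    countᵇ (basisWith f ∘ swapSet M f g) (allSubsets n)  ≡⟨ countᵇ-involution (allSubsets-unique n) allSubsets-complete
                                                                              (swapSet-involutive M f g) (λ _ → refl) ⟩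
    countᵇ (basisWith f) (allSubsets n)                  ∎
    where open ≤-Reasoning

  freer∧b≡⇒swapPreservesBases : Freer M f g → b M f ≡ b M g → SwapPreservesBases
  freer∧b≡⇒swapPreservesBases freer b≡ {B} basis with g ∈? B | f ∈? B
  ... | yes g∈B | _       = freer⇒swapSet-basis freer basis g∈B
  ... | no g∉B  | no f∉B  = subst (λ X → isBasis M X ≡ true) (sym (swapSet-fixes-∉ M f g f∉B g∉B)) basis
  ... | no g∉B  | yes f∈B with isBasis M (swapSet M f g B) in φB-basis
  ...   | true  = refl
  ...   | false = ⊥-elim (<-irrefl (sym b≡) (freer⇒b< freer (cong (_∧ _) φB-basis) fφφB))
    where
    fφφB : basisWith f (swapSet M f g (swapSet M f g B)) ≡ true
    fφφB = subst (λ X → basisWith f X ≡ true) (sym (swapSet-involutive M f g B))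
                 (cong₂ _∧_ basis ([]=⇒lookup f∈B))

theorem11 : ∀ {n} (M : Matroid n) (f g : Fin n) → ¬ (f ≡ g) → Freer M f g →
              ((b M f ≡ b M g → Clones M f g) × (Clones M f g → b M f ≡ b M g))
theorem11 M f g _ freer =
  (λ b≡ → swapPreservesBases⇒clones M f g (freer∧b≡⇒swapPreservesBases M f g freer b≡)) ,
  (λ clones → swapPreservesBases⇒b≡ M f g (clones⇒swapPreservesBases M f g clones))
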